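{- Let $a$ and $b$ be relatively prime positive integers and $u$ and $v$ indeterminates. Let $\Delta\subseteq\mathbb{R}^2$ be the triangle with vertices $(0,0)$, $(a,0)$, and $(0,b)$. Then \[ (u-1) \, \sigma_\Delta (u,v) = u^a v \, \mathrm{c}\left( \tfrac{1}{u}, v; a, b \right) + u \left( u^a + v^b \right) - \frac{ v^{b+1} - 1 }{ v-1 } . \]
   Context: For a polytope $\mathcal{P}\subseteq\mathbb{R}^2$, its integer-point transform is $\sigma_{\mathcal{P}}(u,v) := \sum_{(m,n) \in \mathcal{P}\cap\mathbb{Z}^2} u^m v^n$. For positive integers $a,b$ and indeterminates $u,v$, the Dedekind--Carlitz polynomial is $\mathrm{c}(u,v;a,b) := \sum_{k=1}^{b-1} u^{\lfloor ka/b\rfloor} v^{k-1}$, so that $\mathrm{c}(1/u, v; a,b) = \sum_{k=1}^{b-1} u^{ -\lfloor ka/b\rfloor} v^{k-1}$. -}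

module Defs where

open import Algebra.Bundles using (CommutativeRing)
open import Data.Nat using (ℕ; zero; suc; _+_; _*_; _∸_; _≤ᵇ_; NonZero)
open import Data.Nat.DivMod using (_/_)
open import Data.List using (List; map; foldr; upTo)
open import Data.Bool using (if_then_else_)

module _ {c ℓ} (R : CommutativeRing c ℓ) where
  open CommutativeRing R renaming (_+_ to _+R_; _*_ to _*R_)

  pow : Carrier → ℕ → Carrier
  pow x zero    = 1#
  pow x (suc n) = x *R pow x n

  sumR : List Carrier → Carrier
  sumR = foldr _+R_ 0#

  -- sumRange lo hi f = Σ_{k = lo}^{hi} f k   (empty if hi < lo)
  sumRange : ℕ → ℕ → (ℕ → Carrier) → Carrier
  sumRange lo hi f = sumR (map (λ i → f (lo + i)) (upTo (suc hi ∸ lo)))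

  carlitz : Carrier → Carrier → (a b : ℕ) → .{{NonZero b}} → Carrier
  carlitz x y a b = sumRange 1 (b ∸ 1) (λ k → pow x ((k * a) / b) *R pow y (k ∸ 1))

  -- integer-point transform of the closed triangle with vertices (0,0),(a,0),(0,b):
  -- lattice points (m,n) with m ≥ 0, n ≥ 0, b m + a n ≤ a b (these have m ≤ a, n ≤ b)
  sigmaTriangle : (a b : ℕ) → Carrier → Carrier → Carrier
  sigmaTriangle a b u v =
    sumRange 0 a (λ m → sumRange 0 b (λ n →
      if (b * m + a * n ≤ᵇ a * b) then pow u m *R pow v n else 0#))

  -- the polynomial (v^{b+1} - 1)/(v - 1) = Σ_{j=0}^{b} v^j
  geomQuot : Carrier → ℕ → Carrier
  geomQuot v b = sumRange 0 b (pow v)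

-- Sum Δ row by row: the lattice points of row n ≤ b are (m, n) with
-- m ≤ ℓ(n) = ⌊a(b-n)/b⌋, so σ_Δ = Σ_n (Σ_{m ≤ ℓ(n)} u^m) v^n.  Each inner
-- geometric sum telescopes, u·Σ_{m ≤ ℓ} u^m + 1 = Σ_{m ≤ ℓ} u^m + u^{ℓ+1},
-- hence u·σ_Δ + Σ_{n ≤ b} v^n = σ_Δ + Σ_{n ≤ b} u^{ℓ(n)+1} v^n.  In the last
-- sum the bottom row (ℓ(0) = a) gives u^{a+1} and the top row (ℓ(b) = 0)
-- gives u v^b; for an interior row 0 < n < b coprimality makes b ∤ na, so
-- ℓ(n) + 1 + ⌊na/b⌋ = a and u^{ℓ(n)+1} v^n = u^a v · u^{-⌊na/b⌋} v^{n-1}, the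
-- n-th Dedekind–Carlitz term scaled by u^a v.

module Submission where

open import Defs
open import Algebra.Bundles using (CommutativeRing)
open import Data.Nat as ℕ using (ℕ; NonZero; zero; suc; _∸_; _≤ᵇ_; z≤n; s≤s)
open import Data.Nat.Coprimality using (Coprime)
import Data.Nat.DivMod as ℕ
open import Data.Fin.Base using (toℕ; inject₁; fromℕ)
open import Data.Fin.Properties using (toℕ<n; toℕ-inject₁; toℕ-fromℕ)
open import Data.Bool.Base using (true; false; if_then_else_)
open import Data.List.Base using (applyUpTo)
open import Data.List.Properties using (map-applyUpTo)
open import Data.Vec.Functional using (Vector)
open import Function.Base using (_∘_)
import Relation.Binary.PropositionalEquality as ≡

module TriangleArithmetic where
  open import Data.Nat
  open import Data.Nat.Properties
  open import Data.Nat.DivMod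
  open import Data.Nat.Divisibility using (_∣_; n∣m*n; m%n≡0⇒n∣m; >⇒∤)
  open import Data.Nat.Coprimality as Coprime using (Coprime; coprime-divisor)
  open import Relation.Nullary.Negation using (¬_)
  open import Relation.Nullary.Reflects using (det; fromEquivalence)
  open import Relation.Binary.PropositionalEquality
  import Data.Nat.Solver as ℕ-Solver
  open ℕ-Solver.+-*-Solver using (solve; _:+_; _:*_; _:=_)

  ≤ᵇ-cong-⇔ : ∀ {x y m n} → (x ≤ y → m ≤ n) → (m ≤ n → x ≤ y) → (x ≤ᵇ y) ≡ (m ≤ᵇ n)
  ≤ᵇ-cong-⇔ {x} {y} {m} {n} to from =
    det (≤ᵇ-reflects-≤ x y) (fromEquivalence (λ t → from (≤ᵇ⇒≤ m n t)) (λ x≤y → ≤⇒≤ᵇ (to x≤y)))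

  m*d≤n⇒m≤n/d : ∀ {m n} d .{{_ : NonZero d}} → m * d ≤ n → m ≤ n / d
  m*d≤n⇒m≤n/d {m} {n} d h = subst (_≤ n / d) (m*n/n≡m m d) (/-monoˡ-≤ d h)

  m≤n/d⇒m*d≤n : ∀ {m n} d .{{_ : NonZero d}} → m ≤ n / d → m * d ≤ n
  m≤n/d⇒m*d≤n {m} {n} d h = ≤-trans (*-monoˡ-≤ d h) (m/n*n≤m n d)

  [s+t*d]/d≡t : ∀ {s} t {d} .{{_ : NonZero d}} → s < d → (s + t * d) / d ≡ t
  [s+t*d]/d≡t {s} t {d} s<d = begin
    (s + t * d) / d     ≡⟨ +-distrib-/-∣ʳ s (n∣m*n t) ⟩
    s / d + t * d / d   ≡⟨ cong₂ _+_ (m<n⇒m/n≡0 s<d) (m*n/n≡m t d) ⟩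
    t                   ∎
    where open ≡-Reasoning

  floor-complement : ∀ {x y} c d .{{_ : NonZero d}} → x + y ≡ c * d → ¬ d ∣ y →
                     suc (x / d) + y / d ≡ c
  floor-complement {x} {y} c d x+y≡cd d∤y = begin
    suc (x / d) + q                 ≡⟨ cong suc (+-comm (x / d) q) ⟩
    suc q + x / d                   ≡⟨ +-comm (suc q) (x / d) ⟩
    x / d + suc q                   ≡⟨ cong (x / d +_) (m*n/n≡m (suc q) d) ⟨
    x / d + suc q * d / d           ≡⟨ +-distrib-/-∣ʳ x (n∣m*n (suc q)) ⟨
    (x + suc q * d) / d             ≡⟨ cong (_/ d) shifted ⟩
    (d ∸ r + c * d) / d             ≡⟨ [s+t*d]/d≡t c (∸-monoʳ-< (n≢0⇒n>0 r≢0) (m%n≤n y d)) ⟩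
    c                               ∎
    where
    open ≡-Reasoning
    q r : ℕ
    q = y / d
    r = y % d
    r≢0 : ¬ r ≡ 0
    r≢0 r≡0 = d∤y (m%n≡0⇒n∣m y d r≡0)
    -- adding (q+1)·d to x amounts to replacing y by the complement d - r of its remainder
    shifted : x + suc q * d ≡ d ∸ r + c * d
    shifted = begin
      x + (d + q * d)               ≡⟨ cong (λ z → x + (z + q * d)) (m∸n+n≡m (m%n≤n y d)) ⟨
      x + ((d ∸ r + r) + q * d)     ≡⟨ solve 5 (λ x s r q d → x :+ ((s :+ r) :+ q :* d) := s :+ (x :+ (r :+ q :* d))) refl x (d ∸ r) r q d ⟩
      d ∸ r + (x + (r + q * d))     ≡⟨ cong (λ z → d ∸ r + (x + z)) (m≡m%n+[m/n]*n y d) ⟨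
      d ∸ r + (x + y)               ≡⟨ cong (d ∸ r +_) x+y≡cd ⟩
      d ∸ r + c * d                 ∎

  -- Length of the n-th row of the triangle with vertices (0,0), (a,0), (0,b):
  -- the largest m with b·m + a·n ≤ a·b, namely ⌊a(b-n)/b⌋.
  rowLength : (a b : ℕ) .{{_ : NonZero b}} → ℕ → ℕ
  rowLength a b n = a * (b ∸ n) / b

  a*[b∸n]+a*n≡a*b : ∀ a {b n} → n ≤ b → a * (b ∸ n) + a * n ≡ a * b
  a*[b∸n]+a*n≡a*b a {b} {n} n≤b =
    trans (sym (*-distribˡ-+ a (b ∸ n) n)) (cong (a *_) (m∸n+n≡m n≤b))

  inTriangle⇔inRow : ∀ a b .{{_ : NonZero b}} {n} m → n ≤ b →
                     (b * m + a * n ≤ᵇ a * b) ≡ (m ≤ᵇ rowLength a b n)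
  inTriangle⇔inRow a b {n} m n≤b = ≤ᵇ-cong-⇔ to from
    where
    split : a * (b ∸ n) + a * n ≡ a * b
    split = a*[b∸n]+a*n≡a*b a n≤b
    to : b * m + a * n ≤ a * b → m ≤ rowLength a b n
    to h = m*d≤n⇒m≤n/d b (subst (_≤ a * (b ∸ n)) (*-comm b m)
             (+-cancelʳ-≤ (a * n) (b * m) (a * (b ∸ n)) (subst (b * m + a * n ≤_) (sym split) h)))
    from : m ≤ rowLength a b n → b * m + a * n ≤ a * b
    from h = subst (b * m + a * n ≤_) split
               (+-monoˡ-≤ (a * n) (subst (_≤ a * (b ∸ n)) (*-comm m b) (m≤n/d⇒m*d≤n b h)))

  rowLength-bottom : ∀ a b .{{_ : NonZero b}} → rowLength a b 0 ≡ a
  rowLength-bottom a b = m*n/n≡m a b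

  rowLength-top : ∀ a b .{{_ : NonZero b}} → rowLength a b b ≡ 0
  rowLength-top a b rewrite n∸n≡0 b | *-zeroʳ a = 0/n≡0 b

  rowLength≤a : ∀ a b .{{_ : NonZero b}} n → rowLength a b n ≤ a
  rowLength≤a a b n = subst (rowLength a b n ≤_) (m*n/n≡m a b) (/-monoˡ-≤ b (*-monoʳ-≤ a (m∸n≤m b n)))

  rowLength-complement : ∀ a b .{{_ : NonZero b}} → Coprime a b → ∀ n → 0 < n → n < b →
                         suc (rowLength a b n) + n * a / b ≡ a
  rowLength-complement a b coprime n 0<n n<b =
    floor-complement a b (trans (cong (a * (b ∸ n) +_) (*-comm n a)) (a*[b∸n]+a*n≡a*b a (<⇒≤ n<b))) b∤na
    where
    b∤na : ¬ b ∣ n * a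
    b∤na b∣na = >⇒∤ {{>-nonZero 0<n}} n<b (coprime-divisor (Coprime.sym coprime) (subst (b ∣_) (*-comm n a) b∣na))

open TriangleArithmetic
  using (rowLength; inTriangle⇔inRow; rowLength-bottom; rowLength-top; rowLength≤a; rowLength-complement)

module _ {c ℓ} (R : CommutativeRing c ℓ) where
  open CommutativeRing R
  open import Algebra.Properties.Semiring.Sum semiring
    using (sum; sum-syntax; sum-cong-≋; sum-cong-≗; sum-init-last; sum-replicate-zero; ∑-comm; ∑-distrib-+; *-distribˡ-sum; *-distribʳ-sum)
  open import Algebra.Properties.Ring ring using (-1*x≈-x)
  open import Algebra.Solver.Ring.NaturalCoefficients.Default commutativeSemiring
  open import Relation.Binary.Reasoning.Setoid setoid

  sumR-applyUpTo : ∀ n (g : ℕ → Carrier) → sumR R (applyUpTo g n) ≡.≡ ∑[ i < n ] g (toℕ i)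
  sumR-applyUpTo zero    g = ≡.refl
  sumR-applyUpTo (suc n) g = ≡.cong (g 0 +_) (sumR-applyUpTo n (g ∘ suc))

  sumRange≡∑ : ∀ lo hi f → sumRange R lo hi f ≡.≡ ∑[ i < suc hi ∸ lo ] f (lo ℕ.+ toℕ i)
  sumRange≡∑ lo hi f =
    ≡.trans (≡.cong (sumR R) (map-applyUpTo (λ i → i) (λ i → f (lo ℕ.+ i)) (suc hi ∸ lo)))
            (sumR-applyUpTo (suc hi ∸ lo) (λ i → f (lo ℕ.+ i)))

  pow-+ : ∀ x m n → pow R x (m ℕ.+ n) ≈ pow R x m * pow R x n
  pow-+ x zero    n = sym (*-identityˡ _)
  pow-+ x (suc m) n = trans (*-cong refl (pow-+ x m n)) (sym (*-assoc _ _ _))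

  pow-inverse : ∀ {x y} → x * y ≈ 1# → ∀ q → pow R x q * pow R y q ≈ 1#
  pow-inverse         xy≈1 zero    = *-identityˡ 1#
  pow-inverse {x} {y} xy≈1 (suc q) = begin
    (x * pow R x q) * (y * pow R y q) ≈⟨ solve 4 (λ x X y Y → (x :* X) :* (y :* Y) := (x :* y) :* (X :* Y)) refl x (pow R x q) y (pow R y q) ⟩
    (x * y) * (pow R x q * pow R y q) ≈⟨ *-cong xy≈1 (pow-inverse xy≈1 q) ⟩
    1# * 1#                           ≈⟨ *-identityˡ 1# ⟩
    1#                                ∎

  if-zero-hom : ∀ (f : Carrier → Carrier) → f 0# ≈ 0# → ∀ b x →
                (if b then f x else 0#) ≈ f (if b then x else 0#)
  if-zero-hom f f0≈0 true  x = refl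
  if-zero-hom f f0≈0 false x = sym f0≈0

  truncGeom : Carrier → (N K : ℕ) → Carrier
  truncGeom x N K = ∑[ m < suc N ] (if toℕ m ≤ᵇ K then pow R x (toℕ m) else 0#)

  truncGeom-telescope : ∀ x N K → K ℕ.≤ N → x * truncGeom x N K + 1# ≈ truncGeom x N K + pow R x (suc K)
  truncGeom-telescope x N zero z≤n = begin
    x * (1# + Z) + 1# ≈⟨ +-cong (*-cong refl (+-cong refl Z≈0)) refl ⟩
    x * (1# + 0#) + 1# ≈⟨ solve 1 (λ x → x :* (con 1 :+ con 0) :+ con 1 := (con 1 :+ con 0) :+ x :* con 1) refl x ⟩
    (1# + 0#) + x * 1# ≈⟨ +-cong (+-cong refl (sym Z≈0)) refl ⟩
    (1# + Z) + x * 1# ∎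
    where
    -- the terms m ≥ 1 all fail the test m ≤ 0
    Z : Carrier
    Z = ∑[ m < N ] 0#
    Z≈0 : Z ≈ 0#
    Z≈0 = sum-replicate-zero N
  truncGeom-telescope x (suc N) (suc K) (s≤s K≤N) = begin
    x * (1# + S′) + 1#           ≈⟨ +-cong (*-cong refl (+-cong refl S′≈xS)) refl ⟩
    x * (1# + x * S) + 1#        ≈⟨ +-cong (*-cong refl (+-comm 1# (x * S))) refl ⟩
    x * (x * S + 1#) + 1#        ≈⟨ +-cong (*-cong refl (truncGeom-telescope x N K K≤N)) refl ⟩
    x * (S + pow R x (suc K)) + 1# ≈⟨ solve 3 (λ x S P → x :* (S :+ P) :+ con 1 := (con 1 :+ x :* S) :+ x :* P) refl x S (pow R x (suc K)) ⟩
    (1# + x * S) + x * pow R x (suc K) ≈⟨ +-cong (+-cong refl (sym S′≈xS)) refl ⟩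
    (1# + S′) + x * pow R x (suc K) ∎
    where
    -- dropping the term m = 0 shifts the exponents: the rest is x times the sum for (N, K)
    S S′ : Carrier
    S = truncGeom x N K
    S′ = ∑[ m < suc N ] (if toℕ m ≤ᵇ K then x * pow R x (toℕ m) else 0#)
    S′≈xS : S′ ≈ x * S
    S′≈xS = trans (sum-cong-≋ {suc N} (λ m → if-zero-hom (x *_) (zeroʳ x) (toℕ m ≤ᵇ K) (pow R x (toℕ m))))
                  (sym (*-distribˡ-sum {suc N} x (λ m → if toℕ m ≤ᵇ K then pow R x (toℕ m) else 0#)))

  ∑-telescope : ∀ {n} x (f g h : Vector Carrier n) → (∀ i → x * f i + g i ≈ f i + h i) →
                x * sum f + sum g ≈ sum f + sum h
  ∑-telescope x f g h eq = begin
    x * sum f + sum g                 ≈⟨ +-cong (*-distribˡ-sum x f) refl ⟩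
    sum (λ i → x * f i) + sum g       ≈⟨ ∑-distrib-+ (λ i → x * f i) g ⟨
    ∑[ i < _ ] (x * f i + g i)        ≈⟨ sum-cong-≋ eq ⟩
    ∑[ i < _ ] (f i + h i)            ≈⟨ ∑-distrib-+ f h ⟩
    sum f + sum h                     ∎

  additive⇒difference : ∀ x S g W → x * S + g ≈ S + W → (x - 1#) * S ≈ W - g
  additive⇒difference x S g W h = begin
    (x - 1#) * S                ≈⟨ distribʳ S x (- 1#) ⟩
    x * S + - 1# * S            ≈⟨ +-cong refl (-1*x≈-x S) ⟩
    x * S + - S                 ≈⟨ +-identityʳ _ ⟨
    (x * S + - S) + 0#          ≈⟨ +-cong refl (-‿inverseʳ g) ⟨
    (x * S + - S) + (g - g)     ≈⟨ interchange (x * S) (- S) g (- g) ⟩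
    (x * S + g) + (- S - g)     ≈⟨ +-cong h refl ⟩
    (S + W) + (- S - g)         ≈⟨ interchange S W (- S) (- g) ⟩
    (S - S) + (W - g)           ≈⟨ +-cong (-‿inverseʳ S) refl ⟩
    0# + (W - g)                ≈⟨ +-identityˡ _ ⟩
    W - g                       ∎
    where
    interchange : ∀ p q r s → (p + q) + (r + s) ≈ (p + r) + (q + s)
    interchange = solve 4 (λ p q r s → (p :+ q) :+ (r :+ s) := (p :+ r) :+ (q :+ s)) refl

  module Triangle (a b′ : ℕ) (coprime : Coprime a (suc b′))
                  (u u⁻¹ v : Carrier) (u*u⁻¹≈1 : u * u⁻¹ ≈ 1#) where
    b : ℕ
    b = suc b′

    inΔ : ℕ → ℕ → Carrier
    inΔ m n = if b ℕ.* m ℕ.+ a ℕ.* n ≤ᵇ a ℕ.* b then pow R u m * pow R v n else 0#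

    rowSum : ℕ → Carrier
    rowSum n = truncGeom u a (rowLength a b n)

    -- u^{rowLength n + 1} v^n, the term left over after telescoping row n.
    rowEnd : ℕ → Carrier
    rowEnd n = pow R u (suc (rowLength a b n)) * pow R v n

    σ-by-rows : sigmaTriangle R a b u v ≈ ∑[ n < suc b ] (rowSum (toℕ n) * pow R v (toℕ n))
    σ-by-rows = begin
      sigmaTriangle R a b u v
        ≡⟨ ≡.trans (sumRange≡∑ 0 a _) (sum-cong-≗ {suc a} (λ m → sumRange≡∑ 0 b (inΔ (toℕ m)))) ⟩
      ∑[ m < suc a ] ∑[ n < suc b ] inΔ (toℕ m) (toℕ n)
        ≈⟨ ∑-comm {suc a} {suc b} (λ m n → inΔ (toℕ m) (toℕ n)) ⟩
      ∑[ n < suc b ] ∑[ m < suc a ] inΔ (toℕ m) (toℕ n)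
        ≈⟨ sum-cong-≋ {suc b} (λ n → row (toℕ n) (ℕ.≤-pred (toℕ<n n))) ⟩
      ∑[ n < suc b ] (rowSum (toℕ n) * pow R v (toℕ n)) ∎
      where
      row : ∀ n → n ℕ.≤ b → ∑[ m < suc a ] inΔ (toℕ m) n ≈ rowSum n * pow R v n
      row n n≤b = begin
        ∑[ m < suc a ] inΔ (toℕ m) n
          ≡⟨ sum-cong-≗ {suc a} (λ m → ≡.cong (λ t → if t then pow R u (toℕ m) * pow R v n else 0#) (inTriangle⇔inRow a b (toℕ m) n≤b)) ⟩
        ∑[ m < suc a ] (if toℕ m ≤ᵇ rowLength a b n then pow R u (toℕ m) * pow R v n else 0#)
          ≈⟨ sum-cong-≋ {suc a} (λ m → if-zero-hom (_* pow R v n) (zeroˡ _) (toℕ m ≤ᵇ rowLength a b n) (pow R u (toℕ m))) ⟩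
        ∑[ m < suc a ] ((if toℕ m ≤ᵇ rowLength a b n then pow R u (toℕ m) else 0#) * pow R v n)
          ≈⟨ *-distribʳ-sum {suc a} (pow R v n) (λ m → if toℕ m ≤ᵇ rowLength a b n then pow R u (toℕ m) else 0#) ⟨
        rowSum n * pow R v n ∎

    -- Each row telescopes: u · (row n) + v^n = (row n) + rowEnd n.
    σ-telescope : u * sigmaTriangle R a b u v + geomQuot R v b ≈ sigmaTriangle R a b u v + ∑[ n < suc b ] rowEnd (toℕ n)
    σ-telescope = begin
      u * σ + geomQuot R v b
        ≈⟨ +-cong (*-cong refl σ-by-rows) (reflexive (sumRange≡∑ 0 b (pow R v))) ⟩
      u * ∑[ n < suc b ] rowTerm (toℕ n) + ∑[ n < suc b ] pow R v (toℕ n)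
        ≈⟨ ∑-telescope {suc b} u (rowTerm ∘ toℕ) (pow R v ∘ toℕ) (rowEnd ∘ toℕ) (λ n → telescopeRow (toℕ n)) ⟩
      ∑[ n < suc b ] rowTerm (toℕ n) + ∑[ n < suc b ] rowEnd (toℕ n)
        ≈⟨ +-cong σ-by-rows refl ⟨
      σ + ∑[ n < suc b ] rowEnd (toℕ n) ∎
      where
      σ : Carrier
      σ = sigmaTriangle R a b u v
      rowTerm : ℕ → Carrier
      rowTerm n = rowSum n * pow R v n
      telescopeRow : ∀ n → u * rowTerm n + pow R v n ≈ rowTerm n + rowEnd n
      telescopeRow n = begin
        u * (rowSum n * pow R v n) + pow R v n
          ≈⟨ solve 3 (λ u S V → u :* (S :* V) :+ V := (u :* S :+ con 1) :* V) refl u (rowSum n) (pow R v n) ⟩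
        (u * rowSum n + 1#) * pow R v n
          ≈⟨ *-cong (truncGeom-telescope u a (rowLength a b n) (rowLength≤a a b n)) refl ⟩
        (rowSum n + pow R u (suc (rowLength a b n))) * pow R v n
          ≈⟨ distribʳ _ _ _ ⟩
        rowSum n * pow R v n + rowEnd n ∎

    rowEnd-bottom : rowEnd 0 ≈ u * pow R u a
    rowEnd-bottom = trans (*-identityʳ _) (*-cong refl (reflexive (≡.cong (pow R u) (rowLength-bottom a b))))

    rowEnd-top : rowEnd b ≈ u * pow R v b
    rowEnd-top = *-cong (trans (*-cong refl (reflexive (≡.cong (pow R u) (rowLength-top a b)))) (*-identityʳ u)) refl

    -- In an interior row, u^a v times the k-th Dedekind–Carlitz term is the row end,
    -- because the row length and the Carlitz exponent are complementary.
    rowEnd-interior : ∀ i → i ℕ.< b′ →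
      (pow R u a * v) * (pow R u⁻¹ ((suc i ℕ.* a) ℕ./ b) * pow R v i) ≈ rowEnd (suc i)
    rowEnd-interior i i<b′ = begin
      (pow R u a * v) * (pow R u⁻¹ q * pow R v i)
        ≈⟨ *-cong (*-cong (trans (reflexive (≡.cong (pow R u) (≡.sym complement))) (pow-+ u (suc L) q)) refl) refl ⟩
      ((pow R u (suc L) * pow R u q) * v) * (pow R u⁻¹ q * pow R v i)
        ≈⟨ solve 5 (λ E U w I V → ((E :* U) :* w) :* (I :* V) := (U :* I) :* (E :* (w :* V))) refl
             (pow R u (suc L)) (pow R u q) v (pow R u⁻¹ q) (pow R v i) ⟩
      (pow R u q * pow R u⁻¹ q) * rowEnd (suc i)
        ≈⟨ *-cong (pow-inverse u*u⁻¹≈1 q) refl ⟩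
      1# * rowEnd (suc i)
        ≈⟨ *-identityˡ _ ⟩
      rowEnd (suc i) ∎
      where
      q : ℕ
      q = (suc i ℕ.* a) ℕ./ b
      L : ℕ
      L = rowLength a b (suc i)
      complement : suc L ℕ.+ q ≡.≡ a
      complement = rowLength-complement a b coprime (suc i) (s≤s z≤n) (s≤s i<b′)

    rowEnd-sum : ∑[ n < suc b ] rowEnd (toℕ n) ≈ (pow R u a * v) * carlitz R u⁻¹ v a b + u * (pow R u a + pow R v b)
    rowEnd-sum = begin
      rowEnd 0 + ∑[ i < b ] rowEnd (suc (toℕ i))
        ≈⟨ +-cong refl (sum-init-last {b′} (λ i → rowEnd (suc (toℕ i)))) ⟩
      rowEnd 0 + (∑[ i < b′ ] rowEnd (suc (toℕ (inject₁ i))) + rowEnd (suc (toℕ (fromℕ b′))))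
        ≡⟨ ≡.cong₂ (λ s t → rowEnd 0 + (s + rowEnd (suc t)))
             (sum-cong-≗ {b′} (λ i → ≡.cong (rowEnd ∘ suc) (toℕ-inject₁ i))) (toℕ-fromℕ b′) ⟩
      rowEnd 0 + (∑[ i < b′ ] rowEnd (suc (toℕ i)) + rowEnd b)
        ≈⟨ +-cong rowEnd-bottom (+-cong interior rowEnd-top) ⟩
      u * pow R u a + (C + u * pow R v b)
        ≈⟨ solve 4 (λ u A C V → u :* A :+ (C :+ u :* V) := C :+ u :* (A :+ V)) refl u (pow R u a) C (pow R v b) ⟩
      C + u * (pow R u a + pow R v b) ∎
      where
      C : Carrier
      C = (pow R u a * v) * carlitz R u⁻¹ v a b
      carlitzTerm : ℕ → Carrier
      carlitzTerm k = pow R u⁻¹ ((k ℕ.* a) ℕ./ b) * pow R v (k ∸ 1)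
      interior : ∑[ i < b′ ] rowEnd (suc (toℕ i)) ≈ C
      interior = sym (begin
        C ≡⟨ ≡.cong ((pow R u a * v) *_) (sumRange≡∑ 1 b′ carlitzTerm) ⟩
        (pow R u a * v) * ∑[ i < b′ ] (pow R u⁻¹ ((suc (toℕ i) ℕ.* a) ℕ./ b) * pow R v (toℕ i))
          ≈⟨ *-distribˡ-sum {b′} (pow R u a * v) (carlitzTerm ∘ suc ∘ toℕ) ⟩
        ∑[ i < b′ ] ((pow R u a * v) * (pow R u⁻¹ ((suc (toℕ i) ℕ.* a) ℕ./ b) * pow R v (toℕ i)))
          ≈⟨ sum-cong-≋ {b′} (λ i → rowEnd-interior (toℕ i) (toℕ<n i)) ⟩
        ∑[ i < b′ ] rowEnd (suc (toℕ i)) ∎)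

    theorem : (u - 1#) * sigmaTriangle R a b u v
              ≈ ((pow R u a * v) * carlitz R u⁻¹ v a b + u * (pow R u a + pow R v b)) - geomQuot R v b
    theorem = additive⇒difference u _ _ _ (trans σ-telescope (+-cong refl rowEnd-sum))

theorem13 : ∀ {c ℓ} (R : CommutativeRing c ℓ) (a b : ℕ) .{{_ : NonZero a}} .{{_ : NonZero b}} →
    Coprime a b →
    (u uinv v : CommutativeRing.Carrier R) →
    CommutativeRing._≈_ R (CommutativeRing._*_ R u uinv) (CommutativeRing.1# R) →
    let open CommutativeRing R in
    (u - 1#) * sigmaTriangle R a b u v
      ≈ ((pow R u a * v) * carlitz R uinv v a b + u * (pow R u a + pow R v b)) - geomQuot R v b
theorem13 R a zero     {{_}} {{()}}
theorem13 R a (suc b′) coprime u u⁻¹ v u*u⁻¹≈1 = Triangle.theorem R a b′ coprime u u⁻¹ v u*u⁻¹≈1
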